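{- Let $m\ge1$. If $G=(U\cup V,E)$ is a graph maximizing $h(G)$ among all bipartite graphs with $m$ edges, then $G$ is a difference graph.
   Context: For $x\ge 0$ let $f(x)=x\log x$ (natural logarithm), $f(0)=0$, and $h(G)=\sum_{v\in V(G)} f(\deg v)$. A bipartite graph $G=(U\cup V,E)$ is a difference graph if there are no vertices $u_1,u_2\in U$ and $v_1,v_2\in V$ such that $u_1v_1,u_2v_2\in E$ and $u_1v_2,u_2v_1\notin E$. -}

module Defs where

open import Data.Nat using (ℕ; _^_; _*_)
open import Data.Fin using (Fin)
open import Data.Bool using (Bool; true; false; if_then_else_)
open import Data.List using (List; map; allFin)
open import Data.Nat.ListAction using (sum; product)
open import Data.Product using (_×_)
open import Relation.Binary.PropositionalEquality using (_≡_)
open import Relation.Nullary using (¬_)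

record BipGraph : Set where
  field
    nU  : ℕ
    nV  : ℕ
    adj : Fin nU → Fin nV → Bool
open BipGraph public

ind : Bool → ℕ
ind b = if b then 1 else 0

degU : (G : BipGraph) → Fin (nU G) → ℕ
degU G u = sum (map (λ v → ind (adj G u v)) (allFin (nV G)))

degV : (G : BipGraph) → Fin (nV G) → ℕ
degV G v = sum (map (λ u → ind (adj G u v)) (allFin (nU G)))

edges : BipGraph → ℕ
edges G = sum (map (degU G) (allFin (nU G)))

-- expH G = exp (h G) = ∏_v deg(v)^deg(v)   (with 0^0 = 1, matching f(0) = 0).
-- Since exp is strictly increasing, h G' ≤ h G  iff  expH G' ≤ expH G.
expH : BipGraph → ℕ
expH G = product (map (λ u → degU G u ^ degU G u) (allFin (nU G)))
       * product (map (λ v → degV G v ^ degV G v) (allFin (nV G)))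

IsDifferenceGraph : BipGraph → Set
IsDifferenceGraph G =
  (u₁ u₂ : Fin (nU G)) (v₁ v₂ : Fin (nV G)) →
  ¬ ((adj G u₁ v₁ ≡ true × adj G u₂ v₂ ≡ true) ×
     (adj G u₁ v₂ ≡ false × adj G u₂ v₁ ≡ false))

-- If u₂v ∈ E, u₁v ∉ E and deg u₂ ≤ deg u₁, moving the edge u₂v to u₁v keeps the number of edges
-- and every degree in V, raises deg u₁ by one and lowers deg u₂ by one.  Since n ↦ nⁿ is strictly
-- log-convex, this strictly increases ∏ deg(w)^deg(w) = exp h.  So in a maximiser a vertex missing
-- v has smaller degree than a vertex adjacent to v, and an induced 2K₂ u₁v₁, u₂v₂ would give
-- deg u₁ < deg u₂ < deg u₁.
module Submission where

open import Algebra.Bundles using (CommutativeMonoid)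
import Algebra.Properties.CommutativeMonoid.Sum as CommutativeMonoidSum
import Algebra.Properties.CommutativeSemigroup as CommutativeSemigroupProperties
open import Data.Bool using (Bool; true; false; if_then_else_; _∧_)
open import Data.Fin using (Fin; zero; suc; _≟_)
open import Data.Fin.Properties using (punchInᵢ≢i)
open import Data.List using (map; allFin; tabulate; foldr)
open import Data.List.Properties using (map-tabulate; map-cong)
open import Data.Nat hiding (_≟_)
open import Data.Nat.ListAction using (sum; product)
open import Data.Nat.Properties hiding (_≟_)
open import Data.Nat.Tactic.RingSolver using (solve-∀)
open import Data.Product using (_,_)
open import Data.Vec.Functional using (Vector; removeAt)
import Data.Vec.Functional as Vector
open import Function using (_∘_; id; case_of_)
open import Relation.Binary.PropositionalEquality
  using (_≡_; _≢_; refl; sym; trans; cong; cong₂; subst; subst₂; module ≡-Reasoning)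
open import Relation.Nullary using (does; yes; no)
open import Relation.Nullary.Decidable using (dec-true; dec-false)

open import Defs

module +-Props = CommutativeSemigroupProperties +-commutativeSemigroup
module *-Props = CommutativeSemigroupProperties *-commutativeSemigroup

^-distribʳ-* : ∀ m n o → (m * n) ^ o ≡ m ^ o * n ^ o
^-distribʳ-* m n zero    = refl
^-distribʳ-* m n (suc o) = begin
  m * n * (m * n) ^ o       ≡⟨ cong (m * n *_) (^-distribʳ-* m n o) ⟩
  m * n * (m ^ o * n ^ o)   ≡⟨ *-Props.interchange m n (m ^ o) (n ^ o) ⟩
  m * m ^ o * (n * n ^ o)   ∎
  where open ≡-Reasoning

-- Bernoulli's inequality (1 - x)^j ≥ 1 - j x at x = d / (m + d), cleared of denominators and subtraction.
bernoulli : ∀ m d j → (m + d) ^ j * (m + d) ≤ m ^ j * (m + d) + j * d * (m + d) ^ j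
bernoulli m d zero    = ≤-reflexive (sym (+-identityʳ _))
bernoulli m d (suc j) = begin
  N * N ^ j * N                                ≡⟨ *-assoc N (N ^ j) N ⟩
  N * (N ^ j * N)                              ≤⟨ *-monoʳ-≤ N (bernoulli m d j) ⟩
  N * (m ^ j * N + j * d * N ^ j)              ≡⟨ expand m d (m ^ j) (N ^ j) j ⟩
  m * m ^ j * N + d * (m ^ j * N) + j * d * (N * N ^ j)
    ≤⟨ +-monoˡ-≤ (j * d * (N * N ^ j)) (+-monoʳ-≤ (m * m ^ j * N) (*-monoʳ-≤ d m^jN≤N^j⁺¹)) ⟩
  m * m ^ j * N + d * (N * N ^ j) + j * d * (N * N ^ j)  ≡⟨ collect (m * m ^ j * N) d (N * N ^ j) j ⟩
  m * m ^ j * N + suc j * d * (N * N ^ j)     ∎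
  where
  open ≤-Reasoning
  N = m + d
  m^jN≤N^j⁺¹ : m ^ j * N ≤ N * N ^ j
  m^jN≤N^j⁺¹ = begin
    m ^ j * N ≤⟨ *-monoˡ-≤ N (^-monoˡ-≤ j (m≤m+n m d)) ⟩
    N ^ j * N ≡⟨ *-comm (N ^ j) N ⟩
    N * N ^ j ∎
  expand : ∀ m d x y j → (m + d) * (x * (m + d) + j * d * y)
                       ≡ m * x * (m + d) + d * (x * (m + d)) + j * d * ((m + d) * y)
  expand = solve-∀
  collect : ∀ a d z j → a + d * z + j * d * z ≡ a + suc j * d * z
  collect = solve-∀

module _ (f : ℕ → ℕ) (f-pos : ∀ n → 0 < f n)
         (step : ∀ k → f (suc k) * f (suc k) < f (2 + k) * f k) where

  step⇒logConvex : ∀ {c a} → c < a → f a * f (suc c) < f (suc a) * f c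
  step⇒logConvex c<a = go (<⇒<′ c<a)
    where
    go : ∀ {c a} → c <′ a → f a * f (suc c) < f (suc a) * f c
    go {c} ≤′-refl = step c
    go {c} {suc a} (≤′-step c<a) = *-cancelʳ-< (f a) _ _ (begin-strict
      f (suc a) * f (suc c) * f a    ≡⟨ *-Props.xy∙z≈x∙zy (f (suc a)) (f (suc c)) (f a) ⟩
      f (suc a) * (f a * f (suc c))  <⟨ *-monoʳ-< (f (suc a)) {{>-nonZero (f-pos (suc a))}} (go c<a) ⟩
      f (suc a) * (f (suc a) * f c)  ≡⟨ *-assoc (f (suc a)) (f (suc a)) (f c) ⟨
      f (suc a) * f (suc a) * f c    <⟨ *-monoˡ-< (f c) {{>-nonZero (f-pos c)}} (step a) ⟩
      f (2 + a) * f a * f c          ≡⟨ *-Props.xy∙z≈xz∙y (f (2 + a)) (f a) (f c) ⟩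
      f (2 + a) * f c * f a          ∎)
      where open ≤-Reasoning

selfPow : ℕ → ℕ
selfPow n = n ^ n

selfPow-pos : ∀ n → 0 < selfPow n
selfPow-pos zero    = z<s
selfPow-pos (suc n) = m^n>0 (suc n) (suc n)

-- With N = (k+1)², M = (k+2)k = N - 1 and Q = (k+2)² the claim reads N^k N < Q M^k.  Bernoulli gives
-- N^k N ≤ M^k N + k N^k, and the gap closes because N² + k Q < Q N.
selfPow-logConvex-step : ∀ k → selfPow (suc k) * selfPow (suc k) < selfPow (2 + k) * selfPow k
selfPow-logConvex-step k = subst₂ _<_ (sym lhs≡A*N) (sym rhs≡Q*B) (*-cancelʳ-< N (A * N) (Q * B) A*N*N<Q*B*N)
  where
  N M Q A B : ℕ
  N = suc k * suc k
  M = (2 + k) * k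
  Q = (2 + k) * (2 + k)
  A = N ^ k
  B = M ^ k

  lhs≡A*N : selfPow (suc k) * selfPow (suc k) ≡ A * N
  lhs≡A*N = trans (sym (^-distribʳ-* (suc k) (suc k) (suc k))) (*-comm N A)

  rhs≡Q*B : selfPow (2 + k) * selfPow k ≡ Q * B
  rhs≡Q*B = begin
    (2 + k) ^ (2 + k) * k ^ k            ≡⟨ cong (_* k ^ k) (^-distribˡ-+-* (2 + k) 2 k) ⟩
    (2 + k) ^ 2 * (2 + k) ^ k * k ^ k    ≡⟨ *-assoc ((2 + k) ^ 2) ((2 + k) ^ k) (k ^ k) ⟩
    (2 + k) ^ 2 * ((2 + k) ^ k * k ^ k)  ≡⟨ cong₂ _*_ (cong ((2 + k) *_) (*-identityʳ (2 + k)))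
                                                      (sym (^-distribʳ-* (2 + k) k k)) ⟩
    Q * B                                ∎
    where open ≡-Reasoning

  N≡M+1 : N ≡ M + 1
  N≡M+1 = square k
    where
    square : ∀ k → suc k * suc k ≡ (2 + k) * k + 1
    square = solve-∀

  A*N≤B*N+k*A : A * N ≤ B * N + k * A
  A*N≤B*N+k*A rewrite N≡M+1 =
    ≤-trans (bernoulli M 1 k) (≤-reflexive (cong (λ c → B * (M + 1) + c * (M + 1) ^ k) (*-identityʳ k)))

  N*N+Q*k<Q*N : N * N + Q * k < Q * N
  N*N+Q*k<Q*N = subst (N * N + Q * k <_) (gap k) (m<m+n (N * N + Q * k) z<s)
    where
    gap : ∀ k → suc k * suc k * (suc k * suc k) + (2 + k) * (2 + k) * k + suc (k * k * k + 3 * k * k + 4 * k + 2)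
              ≡ (2 + k) * (2 + k) * (suc k * suc k)
    gap = solve-∀

  A*N*N<Q*B*N : A * N * N < Q * B * N
  A*N*N<Q*B*N = +-cancelʳ-< (Q * k * A) (A * N * N) (Q * B * N) (begin-strict
    A * N * N + Q * k * A  ≡⟨ factor A N Q k ⟩
    A * (N * N + Q * k)    <⟨ *-monoʳ-< A {{>-nonZero (m^n>0 N k)}} N*N+Q*k<Q*N ⟩
    A * (Q * N)            ≡⟨ *-Props.x∙yz≈y∙xz A Q N ⟩
    Q * (A * N)            ≤⟨ *-monoʳ-≤ Q A*N≤B*N+k*A ⟩
    Q * (B * N + k * A)    ≡⟨ expand Q B N k A ⟩
    Q * B * N + Q * k * A  ∎)
    where
    open ≤-Reasoning
    factor : ∀ A N Q k → A * N * N + Q * k * A ≡ A * (N * N + Q * k)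
    factor = solve-∀
    expand : ∀ Q B N k A → Q * (B * N + k * A) ≡ Q * B * N + Q * k * A
    expand = solve-∀

selfPow-logConvex : ∀ {c a} → c < a → selfPow a * selfPow (suc c) < selfPow (suc a) * selfPow c
selfPow-logConvex = step⇒logConvex selfPow selfPow-pos selfPow-logConvex-step

foldr-tabulate : ∀ {a b} {A : Set a} {B : Set b} (_∙_ : A → B → B) (e : B) {n} (f : Fin n → A) →
                 foldr _∙_ e (tabulate f) ≡ Vector.foldr _∙_ e f
foldr-tabulate _∙_ e {zero}  f = refl
foldr-tabulate _∙_ e {suc n} f = cong (f zero ∙_) (foldr-tabulate _∙_ e (f ∘ suc))

module _ {c ℓ} (M : CommutativeMonoid c ℓ) where
  open CommutativeMonoid M
  open CommutativeMonoidSum M using (sum-remove; sum-cong-≋) renaming (sum to ∑)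
  open CommutativeSemigroupProperties commutativeSemigroup using (xy∙z≈zy∙x)
  open import Relation.Binary.Reasoning.Setoid setoid

  sum-exchange : ∀ {n} (f g : Vector Carrier n) (i : Fin n) →
                 (∀ k → k ≢ i → f k ≈ g k) → ∑ f ∙ g i ≈ ∑ g ∙ f i
  sum-exchange {suc n} f g i f≈g = begin
    ∑ f ∙ g i                       ≈⟨ ∙-congʳ (sum-remove f) ⟩
    (f i ∙ ∑ (removeAt f i)) ∙ g i  ≈⟨ ∙-congʳ (∙-congˡ (sum-cong-≋ (λ k → f≈g _ (punchInᵢ≢i i k)))) ⟩
    (f i ∙ ∑ (removeAt g i)) ∙ g i  ≈⟨ xy∙z≈zy∙x (f i) _ (g i) ⟩
    (g i ∙ ∑ (removeAt g i)) ∙ f i  ≈⟨ ∙-congʳ (sum-remove g) ⟨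
    ∑ g ∙ f i                       ∎

module ∑ = CommutativeMonoidSum +-0-commutativeMonoid
module ∏ = CommutativeMonoidSum *-1-commutativeMonoid

∏-pos : ∀ {n} (f : Vector ℕ n) → (∀ i → 0 < f i) → 0 < ∏.sum f
∏-pos {zero}  f f>0 = z<s
∏-pos {suc n} f f>0 = *-mono-< (f>0 zero) (∏-pos (f ∘ suc) (f>0 ∘ suc))

sum-map-allFin : ∀ {n} (f : Fin n → ℕ) → sum (map f (allFin n)) ≡ ∑.sum f
sum-map-allFin f = trans (cong sum (map-tabulate id f)) (foldr-tabulate _+_ 0 f)

product-map-allFin : ∀ {n} (f : Fin n → ℕ) → product (map f (allFin n)) ≡ ∏.sum f
product-map-allFin f = trans (cong product (map-tabulate id f)) (foldr-tabulate _*_ 1 f)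

setEdge : (G : BipGraph) → Fin (nU G) → Fin (nV G) → Bool → BipGraph
setEdge G u v b = record G
  { adj = λ u′ v′ → if does (u′ ≟ u) ∧ does (v′ ≟ v) then b else adj G u′ v′ }

module _ (G : BipGraph) (u : Fin (nU G)) (v : Fin (nV G)) (b : Bool) where

  private
    G′ = setEdge G u v b

  adj-setEdge : adj G′ u v ≡ b
  adj-setEdge rewrite dec-true (u ≟ u) refl | dec-true (v ≟ v) refl = refl

  adj-setEdge-≢ᵘ : ∀ {u′ v′} → u′ ≢ u → adj G′ u′ v′ ≡ adj G u′ v′
  adj-setEdge-≢ᵘ {u′} u′≢u rewrite dec-false (u′ ≟ u) u′≢u = refl

  adj-setEdge-≢ᵛ : ∀ {u′ v′} → v′ ≢ v → adj G′ u′ v′ ≡ adj G u′ v′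
  adj-setEdge-≢ᵛ {u′} {v′} v′≢v rewrite dec-false (v′ ≟ v) v′≢v with does (u′ ≟ u)
  ... | true  = refl
  ... | false = refl

  degU-setEdge : degU G′ u + ind (adj G u v) ≡ degU G u + ind b
  degU-setEdge = begin
    degU G′ u + ind (adj G u v)              ≡⟨ cong (_+ ind (adj G u v)) (sum-map-allFin row′) ⟩
    ∑.sum row′ + ind (adj G u v)             ≡⟨ sum-exchange +-0-commutativeMonoid row′ row v
                                                 (λ _ v′≢v → cong ind (adj-setEdge-≢ᵛ v′≢v)) ⟩
    ∑.sum row + ind (adj G′ u v)             ≡⟨ cong₂ (λ d a → d + ind a) (sym (sum-map-allFin row)) adj-setEdge ⟩
    degU G u + ind b                         ∎
    where
    open ≡-Reasoning
    row row′ : Fin (nV G) → ℕ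
    row  v′ = ind (adj G u v′)
    row′ v′ = ind (adj G′ u v′)

  degU-setEdge-≢ : ∀ {u′} → u′ ≢ u → degU G′ u′ ≡ degU G u′
  degU-setEdge-≢ u′≢u = cong sum (map-cong (λ _ → cong ind (adj-setEdge-≢ᵘ u′≢u)) (allFin (nV G)))

  degV-setEdge : degV G′ v + ind (adj G u v) ≡ degV G v + ind b
  degV-setEdge = begin
    degV G′ v + ind (adj G u v)              ≡⟨ cong (_+ ind (adj G u v)) (sum-map-allFin col′) ⟩
    ∑.sum col′ + ind (adj G u v)             ≡⟨ sum-exchange +-0-commutativeMonoid col′ col u
                                                 (λ _ u′≢u → cong ind (adj-setEdge-≢ᵘ u′≢u)) ⟩
    ∑.sum col + ind (adj G′ u v)             ≡⟨ cong₂ (λ d a → d + ind a) (sym (sum-map-allFin col)) adj-setEdge ⟩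
    degV G v + ind b                         ∎
    where
    open ≡-Reasoning
    col col′ : Fin (nU G) → ℕ
    col  u′ = ind (adj G u′ v)
    col′ u′ = ind (adj G′ u′ v)

  degV-setEdge-≢ : ∀ {v′} → v′ ≢ v → degV G′ v′ ≡ degV G v′
  degV-setEdge-≢ v′≢v = cong sum (map-cong (λ _ → cong ind (adj-setEdge-≢ᵛ v′≢v)) (allFin (nU G)))

  edges-setEdge : edges G′ + ind (adj G u v) ≡ edges G + ind b
  edges-setEdge = +-cancelʳ-≡ (degU G u) _ _ (begin
    edges G′ + ind (adj G u v) + degU G u   ≡⟨ +-Props.xy∙z≈xz∙y (edges G′) _ _ ⟩
    edges G′ + degU G u + ind (adj G u v)   ≡⟨ cong (_+ ind (adj G u v)) edges-exchange ⟩
    edges G + degU G′ u + ind (adj G u v)   ≡⟨ +-assoc (edges G) _ _ ⟩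
    edges G + (degU G′ u + ind (adj G u v)) ≡⟨ cong (edges G +_) degU-setEdge ⟩
    edges G + (degU G u + ind b)            ≡⟨ +-assoc (edges G) _ _ ⟨
    edges G + degU G u + ind b              ≡⟨ +-Props.xy∙z≈xz∙y (edges G) _ _ ⟩
    edges G + ind b + degU G u              ∎)
    where
    open ≡-Reasoning
    edges-exchange : edges G′ + degU G u ≡ edges G + degU G′ u
    edges-exchange = begin
      edges G′ + degU G u              ≡⟨ cong (_+ degU G u) (sum-map-allFin (degU G′)) ⟩
      ∑.sum (degU G′) + degU G u       ≡⟨ sum-exchange +-0-commutativeMonoid (degU G′) (degU G) u
                                            (λ _ → degU-setEdge-≢) ⟩
      ∑.sum (degU G) + degU G′ u       ≡⟨ cong (_+ degU G′ u) (sum-map-allFin (degU G)) ⟨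
      edges G + degU G′ u              ∎

expH-U expH-V : BipGraph → ℕ
expH-U G = ∏.sum (selfPow ∘ degU G)
expH-V G = ∏.sum (selfPow ∘ degV G)

expH≡expH-U*expH-V : ∀ G → expH G ≡ expH-U G * expH-V G
expH≡expH-U*expH-V G =
  cong₂ _*_ (product-map-allFin (selfPow ∘ degU G)) (product-map-allFin (selfPow ∘ degV G))

expH-U-setEdge : ∀ G u v b →
  expH-U (setEdge G u v b) * selfPow (degU G u) ≡ expH-U G * selfPow (degU (setEdge G u v b) u)
expH-U-setEdge G u v b = sum-exchange *-1-commutativeMonoid _ _ u
  (λ _ u′≢u → cong selfPow (degU-setEdge-≢ G u v b u′≢u))

moveEdge : (G : BipGraph) → Fin (nU G) → Fin (nU G) → Fin (nV G) → BipGraph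
moveEdge G from to v = setEdge (setEdge G to v true) from v false

module _ (G : BipGraph) {from to : Fin (nU G)} {v : Fin (nV G)}
         (from-v∈E : adj G from v ≡ true) (to-v∉E : adj G to v ≡ false) where

  private
    G₁ G′ : BipGraph
    G₁ = setEdge G to v true
    G′ = moveEdge G from to v

    from≢to : from ≢ to
    from≢to refl with () ← trans (sym to-v∉E) from-v∈E

    from-v∈E₁ : adj G₁ from v ≡ true
    from-v∈E₁ = trans (adj-setEdge-≢ᵘ G to v true from≢to) from-v∈E

    added : ∀ {x y} → x + ind (adj G to v) ≡ y + ind true → x ≡ suc y
    added p rewrite to-v∉E = trans (sym (+-identityʳ _)) (trans p (+-comm _ 1))

    removed : ∀ {x y} → x + ind (adj G₁ from v) ≡ y + ind false → suc x ≡ y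
    removed p rewrite from-v∈E₁ = trans (+-comm 1 _) (trans p (+-identityʳ _))

    moved : ∀ {x x₁ x′} → x₁ + ind (adj G to v) ≡ x + ind true →
            x′ + ind (adj G₁ from v) ≡ x₁ + ind false → x′ ≡ x
    moved p q = suc-injective (trans (removed q) (added p))

  edges-moveEdge : edges G′ ≡ edges G
  edges-moveEdge = moved (edges-setEdge G to v true) (edges-setEdge G₁ from v false)

  degV-moveEdge : ∀ v′ → degV G′ v′ ≡ degV G v′
  degV-moveEdge v′ = case v′ ≟ v of λ where
    (yes refl) → moved (degV-setEdge G to v true) (degV-setEdge G₁ from v false)
    (no v′≢v)  → trans (degV-setEdge-≢ G₁ from v false v′≢v) (degV-setEdge-≢ G to v true v′≢v)

  expH-U-moveEdge : degU G from ≤ degU G to → expH-U G < expH-U G′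
  expH-U-moveEdge from≤to = *-cancelʳ-< (selfPow d * selfPow (suc c)) _ _ (begin-strict
    expH-U G * (selfPow d * selfPow (suc c))     <⟨ *-monoʳ-< (expH-U G) {{>-nonZero expH-U-pos}} convex ⟩
    expH-U G * (selfPow (suc d) * selfPow c)     ≡⟨ *-assoc (expH-U G) _ _ ⟨
    expH-U G * selfPow (suc d) * selfPow c       ≡⟨ cong (_* selfPow c) step-to ⟨
    expH-U G₁ * selfPow d * selfPow c            ≡⟨ *-Props.xy∙z≈xz∙y (expH-U G₁) _ _ ⟩
    expH-U G₁ * selfPow c * selfPow d            ≡⟨ cong (_* selfPow d) step-from ⟨
    expH-U G′ * selfPow (suc c) * selfPow d      ≡⟨ *-Props.xy∙z≈x∙zy (expH-U G′) _ _ ⟩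
    expH-U G′ * (selfPow d * selfPow (suc c))    ∎)
    where
    open ≤-Reasoning
    d c : ℕ
    d = degU G to
    c = degU G′ from
    suc-c≡from : suc c ≡ degU G from
    suc-c≡from = trans (removed (degU-setEdge G₁ from v false)) (degU-setEdge-≢ G to v true from≢to)
    expH-U-pos : 0 < expH-U G
    expH-U-pos = ∏-pos _ (selfPow-pos ∘ degU G)
    convex : selfPow d * selfPow (suc c) < selfPow (suc d) * selfPow c
    convex = selfPow-logConvex (subst (_≤ d) (sym suc-c≡from) from≤to)
    step-to : expH-U G₁ * selfPow d ≡ expH-U G * selfPow (suc d)
    step-to = trans (expH-U-setEdge G to v true) (cong (λ e → expH-U G * selfPow e) (added (degU-setEdge G to v true)))
    step-from : expH-U G′ * selfPow (suc c) ≡ expH-U G₁ * selfPow c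
    step-from = trans (cong (λ e → expH-U G′ * selfPow e) (removed (degU-setEdge G₁ from v false)))
                      (expH-U-setEdge G₁ from v false)

  expH-moveEdge : degU G from ≤ degU G to → expH G < expH G′
  expH-moveEdge from≤to = begin-strict
    expH G                  ≡⟨ expH≡expH-U*expH-V G ⟩
    expH-U G * expH-V G     <⟨ *-monoˡ-< (expH-V G) {{>-nonZero (∏-pos _ (selfPow-pos ∘ degV G))}}
                                 (expH-U-moveEdge from≤to) ⟩
    expH-U G′ * expH-V G    ≡⟨ cong (expH-U G′ *_) (∏.sum-cong-≗ (cong selfPow ∘ degV-moveEdge)) ⟨
    expH-U G′ * expH-V G′   ≡⟨ expH≡expH-U*expH-V G′ ⟨
    expH G′                 ∎
    where open ≤-Reasoning

ExpHMaximal : BipGraph → Set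
ExpHMaximal G = (G′ : BipGraph) → edges G′ ≡ edges G → expH G′ ≤ expH G

ExpHMaximal⇒degU< : ∀ G {u₁ u₂ v} → ExpHMaximal G →
                    adj G u₁ v ≡ false → adj G u₂ v ≡ true → degU G u₁ < degU G u₂
ExpHMaximal⇒degU< G {u₁} {u₂} {v} maximal u₁v∉E u₂v∈E = ≰⇒> λ u₂≤u₁ →
  <⇒≱ (expH-moveEdge G u₂v∈E u₁v∉E u₂≤u₁) (maximal (moveEdge G u₂ u₁ v) (edges-moveEdge G u₂v∈E u₁v∉E))

lemma6 : (m : ℕ) → 1 ≤ m → (G : BipGraph) → edges G ≡ m →
    ((G' : BipGraph) → edges G' ≡ m → expH G' ≤ expH G) →
    IsDifferenceGraph G
lemma6 m _ G refl maximal u₁ u₂ v₁ v₂ ((u₁v₁∈E , u₂v₂∈E) , (u₁v₂∉E , u₂v₁∉E)) =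
  <-asym (ExpHMaximal⇒degU< G maximal u₁v₂∉E u₂v₂∈E) (ExpHMaximal⇒degU< G maximal u₂v₁∉E u₁v₁∈E)
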